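{- Let $d\ge 1$ be fixed. Suppose a finite group $\Gamma$ has a normal abelian subgroup $H$ with $\Gamma/H\cong\mathbb Z_2^d$. Then $$M_2(\Gamma)\le\left((1-1/2^d)^{1/2}+o(1)\right)|\Gamma|^{1/2},$$ where $o(1)\to0$ as $|\Gamma|\to\infty$.
   Context: For a group $\Gamma$, $A\subseteq\Gamma$ is an $S_2$-set if $\alpha_1\alpha_2=\beta_1\beta_2$ with $\alpha_i,\beta_i\in A$ implies $(\alpha_1,\alpha_2)=(\beta_1,\beta_2)$; $M_2(\Gamma)$ is the maximum size of an $S_2$-set in $\Gamma$. -}

module Defs where

open import Data.Nat using (ℕ; suc; _+_; _*_; _∸_; _^_; _≤_)
open import Data.Fin using (Fin)
open import Data.Fin.Subset using (Subset; _∈_; ∣_∣)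
open import Data.Bool using (Bool; false; _xor_)
open import Data.Vec using (Vec; zipWith; replicate)
open import Data.Product using (_×_; ∃)
open import Relation.Binary.PropositionalEquality using (_≡_)
open import Algebra.Structures using (IsGroup)

record FiniteGroup (n : ℕ) : Set where
  field
    _∙_     : Fin n → Fin n → Fin n
    e       : Fin n
    _⁻¹     : Fin n → Fin n
    isGroup : IsGroup _≡_ _∙_ e _⁻¹

-- The elementary abelian group Z_2^d, as bit vectors under pointwise xor.
_⊕_ : {d : ℕ} → Vec Bool d → Vec Bool d → Vec Bool d
_⊕_ = zipWith _xor_

𝟎 : (d : ℕ) → Vec Bool d
𝟎 d = replicate d false

module _ {n : ℕ} (G : FiniteGroup n) where
  open FiniteGroup G

  IsS2Set : Subset n → Set
  IsS2Set A = ∀ a₁ a₂ b₁ b₂ → a₁ ∈ A → a₂ ∈ A → b₁ ∈ A → b₂ ∈ A →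
              a₁ ∙ a₂ ≡ b₁ ∙ b₂ → (a₁ ≡ b₁) × (a₂ ≡ b₂)

  -- H (given by a membership predicate) is a normal abelian subgroup with
  -- Γ/H ≅ Z_2^d: by the first isomorphism theorem this means there is a
  -- surjective homomorphism φ : Γ → Z_2^d whose kernel is exactly H
  -- (kernels are automatically normal subgroups), and H is abelian.
  HasAbelianNormalSubgroupWithQuotientZ2^ : (d : ℕ) → (Fin n → Set) → Set
  HasAbelianNormalSubgroupWithQuotientZ2^ d H =
    ∃ λ (φ : Fin n → Vec Bool d) →
        (∀ x y → φ (x ∙ y) ≡ φ x ⊕ φ y)
      × (∀ v → ∃ λ x → φ x ≡ v)
      × (∀ x → (H x → φ x ≡ 𝟎 d) × (φ x ≡ 𝟎 d → H x))
      × (∀ x y → H x → H y → x ∙ y ≡ y ∙ x)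

{-# OPTIONS --safe #-}
-- Let a_v = |A ∩ φ⁻¹(v)| for v ∈ Z_2^d. Two elements of A in the abelian kernel H commute, so the
-- Sidon property gives a_0 ≤ 1. If x, y ∈ A lie in one coset then xy ∈ H, because Z_2^d has
-- exponent 2; so for coset representatives g_v the elements (xy) g_v are pairwise distinct over all
-- such pairs (x, y) and all v, whence 2^d Σ a_v² ≤ |Γ|. Writing S for the number of elements of A
-- outside H, |A| ≤ 1 + S, and Cauchy–Schwarz over the 2^d − 1 nontrivial cosets gives
-- S² ≤ (2^d − 1) Σ a_v² ≤ (1 − 2^−d) |Γ|. Once |Γ| ≥ 9 (k + 1)², the remaining linear term 1 + 2S
-- is at most |Γ| / (k + 1).
module Submission where

open import Defs
open import Data.Nat using (ℕ; suc; _+_; _*_; _∸_; _^_; _≤_)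
open import Data.Fin using (Fin)
open import Data.Fin.Subset using (Subset; ∣_∣)
open import Data.Product using (∃)

open import Algebra.Bundles using (Group)
import Algebra.Properties.Group as GroupProperties
open import Data.Bool using (Bool; true; false; if_then_else_)
open import Data.Bool.Properties using (xor-same; xor-identityˡ)
open import Data.Fin using (zero; suc)
open import Data.Fin.Properties using (_≟_; 2↔Bool; *↔×)
import Data.Fin.Properties as Fin
open import Data.Fin.Subset using (_∈_)
open import Data.Fin.Subset.Properties using (_∈?_)
open import Data.Nat using (zero; z≤n; s≤s; _<_)
open import Data.Nat.Properties hiding (_≟_)
open import Data.Nat.Tactic.RingSolver using (solve-∀)
open import Data.Product using (_×_; _,_; proj₁; proj₂; uncurry)
open import Data.Product.Function.NonDependent.Propositional using (_×-↔_)
open import Data.Vec using (Vec; []; _∷_; uncons)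
open import Data.Vec.Properties using (zipWith-identityˡ)
open import Function using (_∘_)
open import Function.Bundles using (_↔_; mk↔ₛ′; Inverse)
open import Function.Construct.Composition using (_↔-∘_)
open import Function.Construct.Symmetry using (↔-sym)
open import Level using (0ℓ)
open import Relation.Binary.PropositionalEquality
open import Relation.Nullary using (Dec; yes; no; does; ¬?; _×-dec_)
open import Algebra.Properties.Semiring.Sum +-*-semiring
open import Algebra.Properties.CommutativeSemigroup *-commutativeSemigroup using (x∙yz≈y∙xz)

private variable
  P Q : Set
  m n : ℕ

⟦_⟧ : Dec P → ℕ
⟦ p ⟧ = if does p then 1 else 0

⟦⟧≤1 : (p : Dec P) → ⟦ p ⟧ ≤ 1
⟦⟧≤1 (yes _) = ≤-refl
⟦⟧≤1 (no _)  = z≤n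

⟦⟧>0⇒ : (p : Dec P) → 0 < ⟦ p ⟧ → P
⟦⟧>0⇒ (yes x) _ = x

⟦⟧*>0⇒ : (p : Dec P) {x : ℕ} → 0 < ⟦ p ⟧ * x → P × 0 < x
⟦⟧*>0⇒ (yes p) {x} ⟦p⟧*x>0 = p , subst (0 <_) (+-identityʳ x) ⟦p⟧*x>0

⟦⟧*⟦⟧≡⟦⟧ : (p : Dec P) → ⟦ p ⟧ * ⟦ p ⟧ ≡ ⟦ p ⟧
⟦⟧*⟦⟧≡⟦⟧ (yes _) = refl
⟦⟧*⟦⟧≡⟦⟧ (no _)  = refl

⟦⟧+⟦¬⟧≡1 : (p : Dec P) → ⟦ p ⟧ + ⟦ ¬? p ⟧ ≡ 1
⟦⟧+⟦¬⟧≡1 (yes _) = refl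
⟦⟧+⟦¬⟧≡1 (no _)  = refl

⟦×-dec⟧ : (p : Dec P) (q : Dec Q) → ⟦ p ×-dec q ⟧ ≡ ⟦ p ⟧ * ⟦ q ⟧
⟦×-dec⟧ (yes _) q = sym (+-identityʳ ⟦ q ⟧)
⟦×-dec⟧ (no _)  q = refl

∣∣≡∑⟦∈?⟧ : (A : Subset n) → ∣ A ∣ ≡ ∑[ x < n ] ⟦ x ∈? A ⟧
∣∣≡∑⟦∈?⟧ []          = refl
∣∣≡∑⟦∈?⟧ (true ∷ A)  = cong suc (∣∣≡∑⟦∈?⟧ A)
∣∣≡∑⟦∈?⟧ (false ∷ A) = ∣∣≡∑⟦∈?⟧ A

sum-mono-≤ : {f g : Fin n → ℕ} → (∀ i → f i ≤ g i) → sum f ≤ sum g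
sum-mono-≤ {zero}  _   = z≤n
sum-mono-≤ {suc n} f≤g = +-mono-≤ (f≤g zero) (sum-mono-≤ (f≤g ∘ suc))

sum-const : ∀ n c → ∑[ i < n ] c ≡ n * c
sum-const zero    c = refl
sum-const (suc n) c = cong (c +_) (sum-const n c)

sum-⟦≟⟧* : (a : Fin n) (f : Fin n → ℕ) → ∑[ i < n ] (⟦ a ≟ i ⟧ * f i) ≡ f a
sum-⟦≟⟧* {suc n} zero    f =
  trans (cong₂ _+_ (+-identityʳ (f zero)) (sum-replicate-zero n)) (+-identityʳ (f zero))
sum-⟦≟⟧* {suc n} (suc a) f = sum-⟦≟⟧* a (f ∘ suc)

sum-split : (a : Fin n) (f : Fin n → ℕ) → sum f ≡ f a + ∑[ i < n ] (⟦ ¬? (a ≟ i) ⟧ * f i)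
sum-split {n} a f = begin
  sum f
    ≡⟨ sum-cong-≗ (λ i → sym (trans (cong (_* f i) (⟦⟧+⟦¬⟧≡1 (a ≟ i))) (*-identityˡ (f i)))) ⟩
  ∑[ i < n ] ((⟦ a ≟ i ⟧ + ⟦ ¬? (a ≟ i) ⟧) * f i)
    ≡⟨ sum-cong-≗ (λ i → *-distribʳ-+ (f i) ⟦ a ≟ i ⟧ _) ⟩
  ∑[ i < n ] (⟦ a ≟ i ⟧ * f i + ⟦ ¬? (a ≟ i) ⟧ * f i)
    ≡⟨ ∑-distrib-+ (λ i → ⟦ a ≟ i ⟧ * f i) _ ⟩
  ∑[ i < n ] (⟦ a ≟ i ⟧ * f i) + rest
    ≡⟨ cong (_+ rest) (sum-⟦≟⟧* a f) ⟩
  f a + rest ∎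
  where
  open ≡-Reasoning
  rest : ℕ
  rest = ∑[ i < n ] (⟦ ¬? (a ≟ i) ⟧ * f i)

sum-*-sum : (f : Fin m → ℕ) (g : Fin n → ℕ) → sum f * sum g ≡ ∑[ i < m ] ∑[ j < n ] (f i * g j)
sum-*-sum f g = trans (*-distribʳ-sum (sum g) f) (sum-cong-≗ (λ i → *-distribˡ-sum (f i) g))

sum>0⇒∃>0 : (w : Fin n → ℕ) → 0 < sum w → ∃ λ i → 0 < w i
sum>0⇒∃>0 {suc n} w sum>0 with 0 <? w zero
... | yes w₀>0 = zero , w₀>0
... | no  w₀≯0
  with i , wᵢ>0 ← sum>0⇒∃>0 (w ∘ suc) (≤-trans sum>0 (+-monoˡ-≤ _ (≮⇒≥ w₀≯0)))
  = suc i , wᵢ>0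

sum≤1 : (w : Fin n → ℕ) → (∀ i → w i ≤ 1) →
        (∀ {i j} → 0 < w i → 0 < w j → i ≡ j) → sum w ≤ 1
sum≤1 {zero}  w _   _      = z≤n
sum≤1 {suc n} w w≤1 unique with 0 <? w zero
... | no  w₀≯0 =
  +-mono-≤ (≮⇒≥ w₀≯0) (sum≤1 (w ∘ suc) (w≤1 ∘ suc) (λ p q → Fin.suc-injective (unique p q)))
... | yes w₀>0 = +-mono-≤ (w≤1 zero) (≤-trans (sum-mono-≤ rest≤0) (≤-reflexive (sum-replicate-zero n)))
  where
  rest≤0 : ∀ i → w (suc i) ≤ 0
  rest≤0 i = ≮⇒≥ (λ wᵢ>0 → Fin.0≢1+n (unique w₀>0 wᵢ>0))

∑∑≤1 : ∀ {a b} (w : Fin a → Fin b → ℕ) → (∀ i j → w i j ≤ 1) →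
       (∀ {i j i′ j′} → 0 < w i j → 0 < w i′ j′ → i ≡ i′ × j ≡ j′) →
       ∑[ i < a ] ∑[ j < b ] w i j ≤ 1
∑∑≤1 w w≤1 unique = sum≤1 (sum ∘ w) inner≤1 outer
  where
  inner≤1 : ∀ i → sum (w i) ≤ 1
  inner≤1 i = sum≤1 (w i) (w≤1 i) (λ p q → proj₂ (unique p q))
  outer : ∀ {i i′} → 0 < sum (w i) → 0 < sum (w i′) → i ≡ i′
  outer {i} {i′} p q with _ , p′ ← sum>0⇒∃>0 (w i) p | _ , q′ ← sum>0⇒∃>0 (w i′) q
    = proj₁ (unique p′ q′)

∑∑∑≤1 : ∀ {a b c} (w : Fin a → Fin b → Fin c → ℕ) → (∀ i j l → w i j l ≤ 1) →
        (∀ {i j l i′ j′ l′} → 0 < w i j l → 0 < w i′ j′ l′ →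
           i ≡ i′ × j ≡ j′ × l ≡ l′) →
        ∑[ i < a ] ∑[ j < b ] ∑[ l < c ] w i j l ≤ 1
∑∑∑≤1 {b = b} w w≤1 unique = sum≤1 (λ i → ∑[ j < b ] sum (w i j)) inner≤1 outer
  where
  inner≤1 : ∀ i → ∑[ j < b ] sum (w i j) ≤ 1
  inner≤1 i = ∑∑≤1 (w i) (w≤1 i) (λ p q → proj₂ (unique p q))
  witness : ∀ i → 0 < ∑[ j < b ] sum (w i j) → ∃ λ j → ∃ λ l → 0 < w i j l
  witness i p with j , q ← sum>0⇒∃>0 (sum ∘ w i) p = j , sum>0⇒∃>0 (w i j) q
  outer : ∀ {i i′} → 0 < ∑[ j < b ] sum (w i j) → 0 < ∑[ j < b ] sum (w i′ j) → i ≡ i′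
  outer {i} {i′} p q with _ , _ , p′ ← witness i p | _ , _ , q′ ← witness i′ q
    = proj₁ (unique p′ q′)

∑∑∑-injective⇒≤ : ∀ {a b c} (w : Fin a → Fin b → Fin c → ℕ) →
  (F : Fin a → Fin b → Fin c → Fin n) →
  (∀ i j l → w i j l ≤ 1) →
  (∀ {i j l i′ j′ l′} → 0 < w i j l → 0 < w i′ j′ l′ →
     F i j l ≡ F i′ j′ l′ → i ≡ i′ × j ≡ j′ × l ≡ l′) →
  ∑[ i < a ] ∑[ j < b ] ∑[ l < c ] w i j l ≤ n
∑∑∑-injective⇒≤ {n} {a} {b} {c} w F w≤1 F-injective = begin
  ∑[ i < a ] ∑[ j < b ] ∑[ l < c ] w i j l
    ≡⟨ sum-cong-≗ (λ i → sum-cong-≗ (λ j → sum-cong-≗ (λ l → sym (sum-fibres i j l)))) ⟩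
  ∑[ i < a ] ∑[ j < b ] ∑[ l < c ] ∑[ z < n ] fibre z i j l
    ≡⟨ sum-cong-≗ (λ i → sum-cong-≗ (λ j → ∑-comm (λ l z → fibre z i j l))) ⟩
  ∑[ i < a ] ∑[ j < b ] ∑[ z < n ] ∑[ l < c ] fibre z i j l
    ≡⟨ sum-cong-≗ (λ i → ∑-comm (λ j z → ∑[ l < c ] fibre z i j l)) ⟩
  ∑[ i < a ] ∑[ z < n ] ∑[ j < b ] ∑[ l < c ] fibre z i j l
    ≡⟨ ∑-comm (λ i z → ∑[ j < b ] ∑[ l < c ] fibre z i j l) ⟩
  ∑[ z < n ] ∑[ i < a ] ∑[ j < b ] ∑[ l < c ] fibre z i j l
    ≤⟨ sum-mono-≤ (λ z → ∑∑∑≤1 (fibre z) (fibre≤1 z) (fibre-unique z)) ⟩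
  ∑[ z < n ] 1
    ≡⟨ trans (sum-const n 1) (*-identityʳ n) ⟩
  n ∎
  where
  open ≤-Reasoning
  fibre : Fin n → Fin a → Fin b → Fin c → ℕ
  fibre z i j l = ⟦ F i j l ≟ z ⟧ * w i j l
  sum-fibres : ∀ i j l → ∑[ z < n ] fibre z i j l ≡ w i j l
  sum-fibres i j l = sum-⟦≟⟧* (F i j l) (λ _ → w i j l)
  fibre≤1 : ∀ z i j l → fibre z i j l ≤ 1
  fibre≤1 z i j l = *-mono-≤ (⟦⟧≤1 (F i j l ≟ z)) (w≤1 i j l)
  fibre-unique : ∀ z {i j l i′ j′ l′} → 0 < fibre z i j l → 0 < fibre z i′ j′ l′ →
                 i ≡ i′ × j ≡ j′ × l ≡ l′
  fibre-unique z {i} {j} {l} {i′} {j′} {l′} p q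
    with F≡z , wᵢⱼₗ>0 ← ⟦⟧*>0⇒ (F i j l ≟ z) p
       | F′≡z , w′>0  ← ⟦⟧*>0⇒ (F i′ j′ l′ ≟ z) q
    = F-injective wᵢⱼₗ>0 w′>0 (trans F≡z (sym F′≡z))

2[m*n]≤m*m+n*n : ∀ m n → 2 * (m * n) ≤ m * m + n * n
2[m*n]≤m*m+n*n zero    n       = z≤n
2[m*n]≤m*m+n*n (suc m) zero    rewrite *-zeroʳ m = z≤n
2[m*n]≤m*m+n*n (suc m) (suc n) = begin
  2 * (suc m * suc n)               ≡⟨ expandˡ m n ⟩
  2 * (m * n) + 2 * (1 + m + n)     ≤⟨ +-monoˡ-≤ _ (2[m*n]≤m*m+n*n m n) ⟩
  m * m + n * n + 2 * (1 + m + n)   ≡⟨ expandʳ m n ⟩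
  suc m * suc m + suc n * suc n     ∎
  where
  open ≤-Reasoning
  expandˡ : ∀ m n → 2 * (suc m * suc n) ≡ 2 * (m * n) + 2 * (1 + m + n)
  expandˡ = solve-∀
  expandʳ : ∀ m n → m * m + n * n + 2 * (1 + m + n) ≡ suc m * suc m + suc n * suc n
  expandʳ = solve-∀

cauchy-schwarz : (f g : Fin n → ℕ) →
  ∑[ i < n ] (f i * g i) * ∑[ i < n ] (f i * g i) ≤ ∑[ i < n ] (f i * f i) * ∑[ i < n ] (g i * g i)
cauchy-schwarz {n} f g = *-cancelˡ-≤ 2 (begin
  2 * (sum fg * sum fg)
    ≡⟨ cong (2 *_) (sum-*-sum fg fg) ⟩
  2 * ∑[ i < n ] ∑[ j < n ] (fg i * fg j)
    ≡⟨ trans (*-distribˡ-sum 2 (λ i → ∑[ j < n ] (fg i * fg j)))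
             (sum-cong-≗ (λ i → *-distribˡ-sum 2 (λ j → fg i * fg j))) ⟩
  ∑[ i < n ] ∑[ j < n ] (2 * (fg i * fg j))
    ≤⟨ sum-mono-≤ (λ i → sum-mono-≤ (λ j → cross i j)) ⟩
  ∑[ i < n ] ∑[ j < n ] (ff i * gg j + ff j * gg i)
    ≡⟨ trans (sum-cong-≗ (λ i → ∑-distrib-+ (λ j → ff i * gg j) _))
             (∑-distrib-+ (λ i → ∑[ j < n ] (ff i * gg j)) _) ⟩
  ∑[ i < n ] ∑[ j < n ] (ff i * gg j) + ∑[ i < n ] ∑[ j < n ] (ff j * gg i)
    ≡⟨ cong₂ _+_ (sym (sum-*-sum ff gg))
                 (trans (∑-comm (λ i j → ff j * gg i)) (sym (sum-*-sum ff gg))) ⟩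
  sum ff * sum gg + sum ff * sum gg
    ≡⟨ cong (sum ff * sum gg +_) (sym (+-identityʳ (sum ff * sum gg))) ⟩
  2 * (sum ff * sum gg) ∎)
  where
  open ≤-Reasoning
  fg ff gg : Fin n → ℕ
  fg i = f i * g i
  ff i = f i * f i
  gg i = g i * g i
  regroup : ∀ a b c d → 2 * (a * d * (c * b)) ≡ 2 * (a * b * (c * d))
  regroup = solve-∀
  square-out : ∀ a b c d → a * d * (a * d) + c * b * (c * b) ≡ a * a * (d * d) + c * c * (b * b)
  square-out = solve-∀
  -- 2 (f i g i) (f j g j) = 2 (f i g j) (f j g i) ≤ (f i g j)² + (f j g i)²
  cross : ∀ i j → 2 * (fg i * fg j) ≤ ff i * gg j + ff j * gg i
  cross i j = subst₂ _≤_ (regroup (f i) (g i) (f j) (g j)) (square-out (f i) (g i) (f j) (g j))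
                (2[m*n]≤m*m+n*n (f i * g j) (f j * g i))

linear-term≤ : ∀ s k {n} → s * s ≤ n → 9 * suc k * suc k ≤ n → (1 + 2 * s) * suc k ≤ n
linear-term≤ s k {n} s²≤n 9c²≤n with s ≤? 3 * suc k
... | yes s≤3c = begin
  (1 + 2 * s) * suc k              ≤⟨ *-monoˡ-≤ (suc k) (+-monoʳ-≤ 1 (*-monoʳ-≤ 2 s≤3c)) ⟩
  (1 + 2 * (3 * suc k)) * suc k    ≤⟨ *-monoˡ-≤ (suc k) (+-monoˡ-≤ (2 * (3 * suc k)) 1≤3c) ⟩
  3 * (3 * suc k) * suc k          ≡⟨ cong (_* suc k) (sym (*-assoc 3 3 (suc k))) ⟩
  9 * suc k * suc k                ≤⟨ 9c²≤n ⟩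
  n                                ∎
  where
  open ≤-Reasoning
  1≤3c : 1 ≤ 3 * suc k
  1≤3c = s≤s z≤n
... | no  s≰3c = begin
  (1 + 2 * s) * suc k              ≤⟨ *-monoˡ-≤ (suc k) (+-monoˡ-≤ (2 * s) 1≤s) ⟩
  3 * s * suc k                    ≡⟨ trans (*-assoc 3 s (suc k)) (x∙yz≈y∙xz 3 s (suc k)) ⟩
  s * (3 * suc k)                  ≤⟨ *-monoʳ-≤ s (≰⇒≥ s≰3c) ⟩
  s * s                            ≤⟨ s²≤n ⟩
  n                                ∎
  where
  open ≤-Reasoning
  1≤s : 1 ≤ s
  1≤s = ≤-trans (s≤s z≤n) (≰⇒≥ s≰3c)

square-bound : ∀ D K c {t s n} → t ≤ 1 + s → D * (s * s) ≤ K * n → (1 + 2 * s) * c ≤ n →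
               t * t * (D * c) ≤ (K * c + D) * n
square-bound D K c {t} {s} {n} t≤1+s Ds²≤Kn linear = begin
  t * t * (D * c)                             ≤⟨ *-monoˡ-≤ (D * c) (*-mono-≤ t≤1+s t≤1+s) ⟩
  (1 + s) * (1 + s) * (D * c)                 ≡⟨ expand s D c ⟩
  D * (s * s) * c + D * ((1 + 2 * s) * c)     ≤⟨ +-mono-≤ (*-monoˡ-≤ c Ds²≤Kn) (*-monoʳ-≤ D linear) ⟩
  K * n * c + D * n                           ≡⟨ collect K n c D ⟩
  (K * c + D) * n                             ∎
  where
  open ≤-Reasoning
  expand : ∀ s D c → (1 + s) * (1 + s) * (D * c) ≡ D * (s * s) * c + D * ((1 + 2 * s) * c)
  expand = solve-∀
  collect : ∀ K n c D → K * n * c + D * n ≡ (K * c + D) * n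
  collect = solve-∀

⊕-same : ∀ {d} (v : Vec Bool d) → v ⊕ v ≡ 𝟎 d
⊕-same []      = refl
⊕-same (x ∷ v) = cong₂ _∷_ (xor-same x) (⊕-same v)

⊕-identityˡ : ∀ {d} (v : Vec Bool d) → 𝟎 d ⊕ v ≡ v
⊕-identityˡ = zipWith-identityˡ xor-identityˡ

-- Indexing Z_2^d by Fin (2 ^ d) makes sums over the cosets of the kernel ordinary sums over Fin.
bits↔Fin : ∀ d → Vec Bool d ↔ Fin (2 ^ d)
bits↔Fin zero    = mk↔ₛ′ (λ _ → zero) (λ _ → []) (λ { zero → refl }) (λ { [] → refl })
bits↔Fin (suc d) = ↔-sym *↔× ↔-∘ ((↔-sym 2↔Bool ×-↔ bits↔Fin d) ↔-∘ uncons↔)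
  where
  uncons↔ : Vec Bool (suc d) ↔ (Bool × Vec Bool d)
  uncons↔ = mk↔ₛ′ uncons (uncurry _∷_) (λ _ → refl) (λ { (_ ∷ _) → refl })

module _ {n : ℕ} (G : FiniteGroup n) where
  open FiniteGroup G

  group : Group 0ℓ 0ℓ
  group = record { Carrier = Fin n; _≈_ = _≡_; _∙_ = _∙_; ε = e; _⁻¹ = _⁻¹; isGroup = isGroup }

  open GroupProperties group using (∙-cancelʳ)

  module CosetCounting {d : ℕ}
    (φ : Fin n → Vec Bool d) (φ-hom : ∀ x y → φ (x ∙ y) ≡ φ x ⊕ φ y)
    (φ-surjective : ∀ v → ∃ λ x → φ x ≡ v)
    {H : Fin n → Set} (ker⊆H : ∀ x → φ x ≡ 𝟎 d → H x)
    (H-abelian : ∀ x y → H x → H y → x ∙ y ≡ y ∙ x)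
    {A : Subset n} (sidon : IsS2Set G A) where

    open Inverse (bits↔Fin d) using ()
      renaming (to to index; from to bits; strictlyInverseˡ to index-bits; strictlyInverseʳ to bits-index)

    index-injective : ∀ {u v} → index u ≡ index v → u ≡ v
    index-injective {u} {v} eq = trans (sym (bits-index u)) (trans (cong bits eq) (bits-index v))

    coset : Fin n → Fin (2 ^ d)
    coset x = index (φ x)

    kernel : Fin (2 ^ d)
    kernel = index (𝟎 d)

    nonKernel? : ∀ j → Dec (kernel ≢ j)
    nonKernel? j = ¬? (kernel ≟ j)

    representative : Fin (2 ^ d) → Fin n
    representative j = proj₁ (φ-surjective (bits j))

    translate : Fin (2 ^ d) → Fin n → Fin n → Fin n
    translate j x y = (x ∙ y) ∙ representative j

    coset-translate : ∀ j {x y} → coset y ≡ coset x → coset (translate j x y) ≡ j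
    coset-translate j {x} {y} eq = trans (cong index φ-translate) (index-bits j)
      where
      open ≡-Reasoning
      g : Fin n
      g = representative j
      φ-translate : φ ((x ∙ y) ∙ g) ≡ bits j
      φ-translate = begin
        φ ((x ∙ y) ∙ g)          ≡⟨ φ-hom (x ∙ y) g ⟩
        φ (x ∙ y) ⊕ φ g          ≡⟨ cong (_⊕ φ g) (φ-hom x y) ⟩
        (φ x ⊕ φ y) ⊕ φ g        ≡⟨ cong (λ v → (φ x ⊕ v) ⊕ φ g) (index-injective eq) ⟩
        (φ x ⊕ φ x) ⊕ φ g        ≡⟨ cong (_⊕ φ g) (⊕-same (φ x)) ⟩
        𝟎 d ⊕ φ g                ≡⟨ ⊕-identityˡ (φ g) ⟩
        φ g                      ≡⟨ proj₂ (φ-surjective (bits j)) ⟩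
        bits j                   ∎

    inCoset : Fin (2 ^ d) → ℕ
    inCoset j = ∑[ x < n ] (⟦ coset x ≟ j ⟧ * ⟦ x ∈? A ⟧)

    outsideKernel : ℕ
    outsideKernel = ∑[ j < 2 ^ d ] (⟦ nonKernel? j ⟧ * inCoset j)

    SameCoset : Fin n → Fin n → Set
    SameCoset x y = x ∈ A × y ∈ A × coset y ≡ coset x

    sameCoset? : ∀ x y → Dec (SameCoset x y)
    sameCoset? x y = x ∈? A ×-dec y ∈? A ×-dec coset y ≟ coset x

    sameCosetPairs : ℕ
    sameCosetPairs = ∑[ x < n ] ∑[ y < n ] ⟦ sameCoset? x y ⟧

    ∣A∣≡∑inCoset : ∣ A ∣ ≡ ∑[ j < 2 ^ d ] inCoset j
    ∣A∣≡∑inCoset = begin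
      ∣ A ∣
        ≡⟨ ∣∣≡∑⟦∈?⟧ A ⟩
      ∑[ x < n ] ⟦ x ∈? A ⟧
        ≡⟨ sum-cong-≗ (λ x → sym (sum-⟦≟⟧* (coset x) (λ _ → ⟦ x ∈? A ⟧))) ⟩
      ∑[ x < n ] ∑[ j < 2 ^ d ] (⟦ coset x ≟ j ⟧ * ⟦ x ∈? A ⟧)
        ≡⟨ ∑-comm (λ x j → ⟦ coset x ≟ j ⟧ * ⟦ x ∈? A ⟧) ⟩
      ∑[ j < 2 ^ d ] inCoset j ∎
      where open ≡-Reasoning

    inCoset-kernel≤1 : inCoset kernel ≤ 1
    inCoset-kernel≤1 = sum≤1 _ (λ x → *-mono-≤ (⟦⟧≤1 (coset x ≟ kernel)) (⟦⟧≤1 (x ∈? A))) unique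
      where
      unique : ∀ {x y} → 0 < ⟦ coset x ≟ kernel ⟧ * ⟦ x ∈? A ⟧ →
               0 < ⟦ coset y ≟ kernel ⟧ * ⟦ y ∈? A ⟧ → x ≡ y
      unique {x} {y} p q
        with x∈H , ⟦x∈A⟧>0 ← ⟦⟧*>0⇒ (coset x ≟ kernel) p
           | y∈H , ⟦y∈A⟧>0 ← ⟦⟧*>0⇒ (coset y ≟ kernel) q
        = proj₁ (sidon x y y x x∈A y∈A y∈A x∈A xy≡yx)
        where
        x∈A : x ∈ A
        x∈A = ⟦⟧>0⇒ (x ∈? A) ⟦x∈A⟧>0
        y∈A : y ∈ A
        y∈A = ⟦⟧>0⇒ (y ∈? A) ⟦y∈A⟧>0
        xy≡yx : x ∙ y ≡ y ∙ x
        xy≡yx = H-abelian x y (ker⊆H x (index-injective x∈H)) (ker⊆H y (index-injective y∈H))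

    ∣A∣≤1+outsideKernel : ∣ A ∣ ≤ 1 + outsideKernel
    ∣A∣≤1+outsideKernel = begin
      ∣ A ∣                              ≡⟨ ∣A∣≡∑inCoset ⟩
      ∑[ j < 2 ^ d ] inCoset j           ≡⟨ sum-split kernel inCoset ⟩
      inCoset kernel + outsideKernel     ≤⟨ +-monoˡ-≤ outsideKernel inCoset-kernel≤1 ⟩
      1 + outsideKernel                  ∎
      where open ≤-Reasoning

    ∑inCoset²≡sameCosetPairs : ∑[ j < 2 ^ d ] (inCoset j * inCoset j) ≡ sameCosetPairs
    ∑inCoset²≡sameCosetPairs = begin
      ∑[ j < 2 ^ d ] (inCoset j * inCoset j)
        ≡⟨ sum-cong-≗ (λ j → sum-*-sum (w j) (w j)) ⟩
      ∑[ j < 2 ^ d ] ∑[ x < n ] ∑[ y < n ] (w j x * w j y)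
        ≡⟨ ∑-comm (λ j x → ∑[ y < n ] (w j x * w j y)) ⟩
      ∑[ x < n ] ∑[ j < 2 ^ d ] ∑[ y < n ] (w j x * w j y)
        ≡⟨ sum-cong-≗ (λ x → ∑-comm (λ j y → w j x * w j y)) ⟩
      ∑[ x < n ] ∑[ y < n ] ∑[ j < 2 ^ d ] (w j x * w j y)
        ≡⟨ sum-cong-≗ (λ x → sum-cong-≗ (λ y → pair-weight x y)) ⟩
      sameCosetPairs ∎
      where
      open ≡-Reasoning
      w : Fin (2 ^ d) → Fin n → ℕ
      w j x = ⟦ coset x ≟ j ⟧ * ⟦ x ∈? A ⟧
      regroup : ∀ a b c e → a * b * (c * e) ≡ a * (b * (e * c))
      regroup = solve-∀
      pair-weight : ∀ x y → ∑[ j < 2 ^ d ] (w j x * w j y) ≡ ⟦ sameCoset? x y ⟧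
      pair-weight x y = begin
        ∑[ j < 2 ^ d ] (w j x * w j y)
          ≡⟨ sum-cong-≗ (λ j → regroup ⟦ coset x ≟ j ⟧ ⟦ x ∈? A ⟧ ⟦ coset y ≟ j ⟧ ⟦ y ∈? A ⟧) ⟩
        ∑[ j < 2 ^ d ] (⟦ coset x ≟ j ⟧ * (⟦ x ∈? A ⟧ * (⟦ y ∈? A ⟧ * ⟦ coset y ≟ j ⟧)))
          ≡⟨ sum-⟦≟⟧* (coset x) (λ j → ⟦ x ∈? A ⟧ * (⟦ y ∈? A ⟧ * ⟦ coset y ≟ j ⟧)) ⟩
        ⟦ x ∈? A ⟧ * (⟦ y ∈? A ⟧ * ⟦ coset y ≟ coset x ⟧)
          ≡⟨ cong (⟦ x ∈? A ⟧ *_) (sym (⟦×-dec⟧ (y ∈? A) (coset y ≟ coset x))) ⟩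
        ⟦ x ∈? A ⟧ * ⟦ y ∈? A ×-dec coset y ≟ coset x ⟧
          ≡⟨ sym (⟦×-dec⟧ (x ∈? A) (y ∈? A ×-dec coset y ≟ coset x)) ⟩
        ⟦ sameCoset? x y ⟧ ∎

    nonKernelCosets≡2^d∸1 : ∑[ j < 2 ^ d ] ⟦ nonKernel? j ⟧ ≡ 2 ^ d ∸ 1
    nonKernelCosets≡2^d∸1 = sym (begin
      2 ^ d ∸ 1
        ≡⟨ cong (_∸ 1) (sym (trans (sum-const (2 ^ d) 1) (*-identityʳ (2 ^ d)))) ⟩
      ∑[ j < 2 ^ d ] 1 ∸ 1
        ≡⟨ cong (_∸ 1) (sum-split kernel (λ _ → 1)) ⟩
      ∑[ j < 2 ^ d ] (⟦ nonKernel? j ⟧ * 1)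
        ≡⟨ sum-cong-≗ (λ j → *-identityʳ ⟦ nonKernel? j ⟧) ⟩
      ∑[ j < 2 ^ d ] ⟦ nonKernel? j ⟧ ∎)
      where open ≡-Reasoning

    outsideKernel²≤[2^d∸1]*sameCosetPairs : outsideKernel * outsideKernel ≤ (2 ^ d ∸ 1) * sameCosetPairs
    outsideKernel²≤[2^d∸1]*sameCosetPairs = begin
      outsideKernel * outsideKernel
        ≤⟨ cauchy-schwarz (λ j → ⟦ nonKernel? j ⟧) inCoset ⟩
      ∑[ j < 2 ^ d ] (⟦ nonKernel? j ⟧ * ⟦ nonKernel? j ⟧) * ∑[ j < 2 ^ d ] (inCoset j * inCoset j)
        ≡⟨ cong₂ _*_ (trans (sum-cong-≗ (⟦⟧*⟦⟧≡⟦⟧ ∘ nonKernel?)) nonKernelCosets≡2^d∸1)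
                     ∑inCoset²≡sameCosetPairs ⟩
      (2 ^ d ∸ 1) * sameCosetPairs ∎
      where open ≤-Reasoning

    2^d*sameCosetPairs≤n : 2 ^ d * sameCosetPairs ≤ n
    2^d*sameCosetPairs≤n = begin
      2 ^ d * sameCosetPairs
        ≡⟨ sym (sum-const (2 ^ d) sameCosetPairs) ⟩
      ∑[ j < 2 ^ d ] ∑[ x < n ] ∑[ y < n ] ⟦ sameCoset? x y ⟧
        ≤⟨ ∑∑∑-injective⇒≤ (λ _ x y → ⟦ sameCoset? x y ⟧) translate
                            (λ _ x y → ⟦⟧≤1 (sameCoset? x y)) injective ⟩
      n ∎
      where
      open ≤-Reasoning
      injective : ∀ {j x y j′ x′ y′} → 0 < ⟦ sameCoset? x y ⟧ → 0 < ⟦ sameCoset? x′ y′ ⟧ →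
                  translate j x y ≡ translate j′ x′ y′ → j ≡ j′ × x ≡ x′ × y ≡ y′
      injective {j} {x} {y} {j′} {x′} {y′} p q eq
        with x∈A , y∈A , xy∈H ← ⟦⟧>0⇒ (sameCoset? x y) p
           | x′∈A , y′∈A , x′y′∈H ← ⟦⟧>0⇒ (sameCoset? x′ y′) q
        = j≡j′ , sidon x y x′ y′ x∈A y∈A x′∈A y′∈A xy≡x′y′
        where
        j≡j′ : j ≡ j′
        j≡j′ = trans (sym (coset-translate j xy∈H)) (trans (cong coset eq) (coset-translate j′ x′y′∈H))
        xy≡x′y′ : x ∙ y ≡ x′ ∙ y′
        xy≡x′y′ = ∙-cancelʳ (representative j) (x ∙ y) (x′ ∙ y′)
                    (trans eq (cong (λ i → translate i x′ y′) (sym j≡j′)))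

    2^d*outsideKernel²≤[2^d∸1]*n : 2 ^ d * (outsideKernel * outsideKernel) ≤ (2 ^ d ∸ 1) * n
    2^d*outsideKernel²≤[2^d∸1]*n = begin
      2 ^ d * (outsideKernel * outsideKernel)
        ≤⟨ *-monoʳ-≤ (2 ^ d) outsideKernel²≤[2^d∸1]*sameCosetPairs ⟩
      2 ^ d * ((2 ^ d ∸ 1) * sameCosetPairs)
        ≡⟨ x∙yz≈y∙xz (2 ^ d) (2 ^ d ∸ 1) sameCosetPairs ⟩
      (2 ^ d ∸ 1) * (2 ^ d * sameCosetPairs)
        ≤⟨ *-monoʳ-≤ (2 ^ d ∸ 1) 2^d*sameCosetPairs≤n ⟩
      (2 ^ d ∸ 1) * n ∎
      where open ≤-Reasoning

    outsideKernel²≤n : outsideKernel * outsideKernel ≤ n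
    outsideKernel²≤n = begin
      outsideKernel * outsideKernel   ≤⟨ outsideKernel²≤[2^d∸1]*sameCosetPairs ⟩
      (2 ^ d ∸ 1) * sameCosetPairs    ≤⟨ *-monoˡ-≤ sameCosetPairs (m∸n≤m (2 ^ d) 1) ⟩
      2 ^ d * sameCosetPairs          ≤⟨ 2^d*sameCosetPairs≤n ⟩
      n                               ∎
      where open ≤-Reasoning

proposition6p4 : (d : ℕ) → 1 ≤ d → (k : ℕ) → ∃ λ (N : ℕ) →
    (n : ℕ) (G : FiniteGroup n) (H : Fin n → Set) →
    HasAbelianNormalSubgroupWithQuotientZ2^ G d H → N ≤ n →
    (A : Subset n) → IsS2Set G A →
    ∣ A ∣ * ∣ A ∣ * (2 ^ d * suc k) ≤ ((2 ^ d ∸ 1) * suc k + 2 ^ d) * n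
proposition6p4 d _ k = 9 * suc k * suc k , λ where
  n G H (φ , φ-hom , φ-surjective , ker⇔H , H-abelian) N≤n A sidon →
    let open CosetCounting G φ φ-hom φ-surjective (λ x → proj₂ (ker⇔H x)) H-abelian sidon
    in square-bound (2 ^ d) (2 ^ d ∸ 1) (suc k)
         ∣A∣≤1+outsideKernel
         2^d*outsideKernel²≤[2^d∸1]*n
         (linear-term≤ outsideKernel k outsideKernel²≤n N≤n)
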